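{- If $\mathsf P$ is an amgis-algebra over a termlike $\sigma$-algebra $\mathsf U$, then $\mathrm{Pow}_\sigma(\mathsf P)$ is a $\sigma$-algebra over $\mathsf U$ (in particular, its $\sigma$-action takes values in $\mathrm{Pow}_\sigma(\mathsf P)$).
   Context: Atoms $\mathbb A$ (countably infinite; $a,b,c$ distinct), permutations, swappings $(a\ b)$, nominal sets, support, $a\#x$, equivariance as standard; $\mathsf N c$ = "for all but finitely many atoms $c$". Termlike $\sigma$-algebra $\mathsf U$: nominal set with equivariant $x[a:=u]$ and equivariant injection $\mathrm{atm}:\mathbb A\to\mathsf U$ (written $a$) satisfying $a[a:=x]=x$; $x[a:=a]=x$; $a\#x\Rightarrow x[a:=u]=x$; $b\#x\Rightarrow x[a:=u]=((b\ a)\cdot x)[b:=u]$; $a\#v\Rightarrow x[a:=u][b:=v]=x[b:=v][a:=u[b:=v]]$. A $\sigma$-algebra over $\mathsf U$: nominal set with equivariant substitution by elements of $\mathsf U$ satisfying the last four axioms. Amgis-algebra over $\mathsf U$: set with permutation action $\mathsf P$ (not necessarily nominal) and equivariant $p[u\Leftarrow a]$ with $a\#v\Rightarrow p[v\Leftarrow b][u\Leftarrow a]=p[u[b:=v]\Leftarrow a][v\Leftarrow b]$. For $X\subseteq|\mathsf P|$: $\pi\cdot X=\{\pi\cdot p\mid p\in X\}$, $X[a:=u]=\{p\mid\mathsf N c.\ p[u\Leftarrow c]\in(c\ a)\cdot X\}$. $\mathrm{Pow}_\sigma(\mathsf P)$: set of finitely supported $X\subseteq|\mathsf P|$ such that (1)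 $\forall u\,\mathsf N a\,\forall p\,(p[u\Leftarrow a]\in X\iff p\in X)$ and (2) $\forall a\,\mathsf N b\,\forall p\,(p[b\Leftarrow a]\in X\iff(b\ a)\cdot p\in X)$, with these actions. -}

module Defs where

open import Level using (Level; _⊔_) renaming (zero to 0ℓ; suc to lsuc)
open import Data.Nat using (ℕ; _≟_)
open import Data.List using (List; []; _∷_; _++_)
open import Data.List.Membership.Propositional using (_∈_; _∉_)
open import Data.List.Membership.Propositional.Properties using (∈-++⁺ˡ; ∈-++⁺ʳ)
open import Data.List.Relation.Unary.Any using (here; there)
open import Data.Product using (Σ; _×_; _,_; proj₁; proj₂)
open import Relation.Nullary using (¬_; yes; no)
open import Relation.Binary using (Setoid; IsEquivalence)
open import Relation.Binary.PropositionalEquality as ≡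
  using (_≡_; _≢_; refl; sym; trans; cong)
open import Data.Empty using (⊥-elim)

Atom : Set
Atom = ℕ

record Perm : Set where
  field
    to      : Atom → Atom
    from    : Atom → Atom
    to-from : ∀ a → to (from a) ≡ a
    from-to : ∀ a → from (to a) ≡ a
    dom     : List Atom
    fixes   : ∀ a → a ∉ dom → to a ≡ a
open Perm public

idPerm : Perm
idPerm = record { to = λ a → a ; from = λ a → a ; to-from = λ _ → refl
                ; from-to = λ _ → refl ; dom = [] ; fixes = λ _ _ → refl }

_∘ₚ_ : Perm → Perm → Perm
π ∘ₚ τ = record
  { to = λ a → to π (to τ a)
  ; from = λ a → from τ (from π a)
  ; to-from = λ a → trans (cong (to π) (to-from τ (from π a))) (to-from π a)
  ; from-to = λ a → trans (cong (from τ) (from-to π (to τ a))) (from-to τ a)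
  ; dom = dom π ++ dom τ
  ; fixes = λ a a∉ → trans (cong (to π) (fixes τ a (λ i → a∉ (∈-++⁺ʳ (dom π) i))))
                           (fixes π a (λ i → a∉ (∈-++⁺ˡ i)))
  }

swapFun : Atom → Atom → Atom → Atom
swapFun a b c with c ≟ a
... | yes _ = b
... | no _ with c ≟ b
...   | yes _ = a
...   | no _ = c

private
  swapFun-b : ∀ a b → swapFun a b b ≡ a
  swapFun-b a b with b ≟ a
  ... | yes b≡a = b≡a
  ... | no _ with b ≟ b
  ...   | yes _ = refl
  ...   | no b≢b = ⊥-elim (b≢b refl)

  swapFun-a : ∀ a b → swapFun a b a ≡ b
  swapFun-a a b with a ≟ a
  ... | yes _ = refl
  ... | no a≢a = ⊥-elim (a≢a refl)

  swapFun-other : ∀ a b c → c ≢ a → c ≢ b → swapFun a b c ≡ c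
  swapFun-other a b c c≢a c≢b with c ≟ a
  ... | yes c≡a = ⊥-elim (c≢a c≡a)
  ... | no _ with c ≟ b
  ...   | yes c≡b = ⊥-elim (c≢b c≡b)
  ...   | no _ = refl

  swapFun-inv : ∀ a b c → swapFun a b (swapFun a b c) ≡ c
  swapFun-inv a b c with c ≟ a
  ... | yes refl = swapFun-b c b
  ... | no c≢a with c ≟ b
  ...   | yes refl = swapFun-a a c
  ...   | no c≢b = swapFun-other a b c c≢a c≢b

  swapFun-fix : ∀ a b c → c ∉ (a ∷ b ∷ []) → swapFun a b c ≡ c
  swapFun-fix a b c c∉ =
    swapFun-other a b c (λ e → c∉ (here e)) (λ e → c∉ (there (here e)))

swap : Atom → Atom → Perm
swap a b = record
  { to = swapFun a b ; from = swapFun a b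
  ; to-from = swapFun-inv a b ; from-to = swapFun-inv a b
  ; dom = a ∷ b ∷ [] ; fixes = swapFun-fix a b }

N : ∀ {ℓ} → (Atom → Set ℓ) → Set ℓ
N φ = Σ (List Atom) λ A → ∀ c → c ∉ A → φ c

module _ {c ℓ} (S : Setoid c ℓ) (act : Perm → Setoid.Carrier S → Setoid.Carrier S) where
  open Setoid S

  record IsPermAction : Set (c ⊔ ℓ) where
    field
      act-cong : ∀ π {x y} → x ≈ y → act π x ≈ act π y
      act-ext  : ∀ {π τ} → (∀ a → to π a ≡ to τ a) → ∀ x → act π x ≈ act τ x
      act-id   : ∀ x → act idPerm x ≈ x
      act-∘    : ∀ π τ x → act (π ∘ₚ τ) x ≈ act π (act τ x)

  Supports : List Atom → Carrier → Set ℓ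
  Supports A x = ∀ π → (∀ a → a ∈ A → to π a ≡ a) → act π x ≈ x

  -- a # x : a lies outside some finite support of x (i.e. outside the least support)
  Fresh : Atom → Carrier → Set ℓ
  Fresh a x = Σ (List Atom) λ A → Supports A x × a ∉ A

  record IsNominal : Set (c ⊔ ℓ) where
    field
      isPermAction : IsPermAction
      finSupp      : ∀ x → Σ (List Atom) λ A → Supports A x

record Termlike : Set₁ where
  field
    U     : Set
    actU  : Perm → U → U
    subU  : U → Atom → U → U          -- subU x a u = x[a:=u]
    atm   : Atom → U
    nominalU : IsNominal (≡.setoid U) actU
  _#U_ : Atom → U → Set
  a #U x = Fresh (≡.setoid U) actU a x
  field
    subU-equivariant : ∀ π x a u → actU π (subU x a u) ≡ subU (actU π x) (to π a) (actU π u)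
    atm-equivariant  : ∀ π a → actU π (atm a) ≡ atm (to π a)
    atm-injective    : ∀ {a b} → atm a ≡ atm b → a ≡ b
    ax-var   : ∀ a x → subU (atm a) a x ≡ x
    ax-id    : ∀ a x → subU x a (atm a) ≡ x
    ax-fresh : ∀ a x u → a #U x → subU x a u ≡ x
    ax-alpha : ∀ a b x u → a ≢ b → b #U x → subU x a u ≡ subU (actU (swap b a) x) b u
    ax-subst : ∀ a b x u v → a ≢ b → a #U v →
               subU (subU x a u) b v ≡ subU (subU x b v) a (subU u b v)

module _ (T : Termlike) where
  open Termlike T

  record IsSigmaAlgebra {c ℓ} (S : Setoid c ℓ)
           (act : Perm → Setoid.Carrier S → Setoid.Carrier S)
           (sub : Setoid.Carrier S → Atom → U → Setoid.Carrier S) : Set (c ⊔ ℓ) where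
    open Setoid S
    field
      nominal    : IsNominal S act
      sub-cong   : ∀ {x y} a u → x ≈ y → sub x a u ≈ sub y a u
      sub-equivariant : ∀ π x a u → act π (sub x a u) ≈ sub (act π x) (to π a) (actU π u)
      ax-id    : ∀ a x → sub x a (atm a) ≈ x
      ax-fresh : ∀ a x u → Fresh S act a x → sub x a u ≈ x
      ax-alpha : ∀ a b x u → a ≢ b → Fresh S act b x → sub x a u ≈ sub (act (swap b a) x) b u
      ax-subst : ∀ a b x u v → a ≢ b → a #U v →
                 sub (sub x a u) b v ≈ sub (sub x b v) a (subU u b v)

  record Amgis : Set₁ where
    field
      P     : Set
      actP  : Perm → P → P
      amg   : P → U → Atom → P        -- amg p u a = p[u ⇐ a]
      permAction : IsPermAction (≡.setoid P) actP
      amg-equivariant : ∀ π p u a → actP π (amg p u a) ≡ amg (actP π p) (actU π u) (to π a)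
      amg-ax : ∀ a b p u v → a ≢ b → a #U v →
               amg (amg p v b) u a ≡ amg (amg p (subU u b v) a) v b

  module PowSigma (𝒫 : Amgis) where
    open Amgis 𝒫

    Subset : Set₁
    Subset = P → Set

    _·ˢ_ : Perm → Subset → Subset
    (π ·ˢ X) q = Σ P λ p → X p × actP π p ≡ q

    _[_≔_]ˢ : Subset → Atom → U → Subset
    (X [ a ≔ u ]ˢ) p = N λ c → ((swap c a) ·ˢ X) (amg p u c)

    _≐_ : Subset → Subset → Set
    X ≐ Y = ∀ p → (X p → Y p) × (Y p → X p)

    FinSupp : Subset → Set
    FinSupp X = Σ (List Atom) λ A → ∀ π → (∀ a → a ∈ A → to π a ≡ a) → (π ·ˢ X) ≐ X

    Cond1 : Subset → Set
    Cond1 X = ∀ u → N λ a → ∀ p → (X (amg p u a) → X p) × (X p → X (amg p u a))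

    Cond2 : Subset → Set
    Cond2 X = ∀ a → N λ b → ∀ p → (X (amg p (atm b) a) → X (actP (swap b a) p))
                                  × (X (actP (swap b a) p) → X (amg p (atm b) a))

    InPow : Subset → Set
    InPow X = FinSupp X × Cond1 X × Cond2 X

    PowCarrier : Set₁
    PowCarrier = Σ Subset InPow

    PowSetoid : Setoid (lsuc 0ℓ) 0ℓ
    PowSetoid = record
      { Carrier = PowCarrier
      ; _≈_ = λ X Y → proj₁ X ≐ proj₁ Y
      ; isEquivalence = record
        { refl = λ p → (λ x → x) , (λ x → x)
        ; sym = λ e p → proj₂ (e p) , proj₁ (e p)
        ; trans = λ e f p → (λ x → proj₁ (f p) (proj₁ (e p) x))
                          , (λ x → proj₂ (e p) (proj₂ (f p) x)) } }

    ActClosed : Set₁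
    ActClosed = ∀ π X → InPow X → InPow (π ·ˢ X)

    SubClosed : Set₁
    SubClosed = ∀ X a u → InPow X → InPow (X [ a ≔ u ]ˢ)

    actPow : ActClosed → Perm → PowCarrier → PowCarrier
    actPow cl π X = (π ·ˢ proj₁ X) , cl π (proj₁ X) (proj₂ X)

    subPow : SubClosed → PowCarrier → Atom → U → PowCarrier
    subPow cl X a u = (proj₁ X [ a ≔ u ]ˢ) , cl (proj₁ X) a u (proj₂ X)

-- Conditions (1) and (2) quantify cofinitely, but for X supported by a finite A they
-- hold at every atom fresh for A (and for u): swap the given atom with a cofinitely good
-- one that is also fresh, a swap under which X is invariant. In this uniform form they
-- are preserved by permutations and by X ↦ X[a:=u]. Using the amgis axiom and (2),
-- membership p ∈ X[a:=u] can moreover be tested at any single fresh c, so the cofinite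
-- quantifier in X[a:=u] behaves like a fresh-name quantifier; each σ-algebra axiom then
-- reduces, at suitably fresh atoms, to the amgis axiom and the corresponding axiom of U.
module Submission where

open import Defs

open import Data.Empty using (⊥-elim)
open import Data.List using (List; []; _∷_; _++_; map)
open import Data.List.Extrema.Nat using (max; v<max⁺)
open import Data.List.Membership.Propositional using (_∈_; _∉_)
open import Data.List.Membership.Propositional.Properties
  using (∈-++⁺ˡ; ∈-++⁺ʳ; ∈-++⁻; ∈-map⁺; ∈-map⁻)
open import Data.List.Relation.Unary.Any as Any using (here; there)
open import Data.Nat using (suc; _≟_)
open import Data.Nat.Properties using (<-irrefl; n<1+n)
open import Data.Product using (Σ; ∃; _×_; _,_; proj₁; proj₂)
open import Data.Sum using (inj₁; inj₂)
open import Relation.Nullary using (Dec; yes; no)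
open import Relation.Binary.PropositionalEquality as ≡
  using (_≡_; _≢_; refl; sym; trans; cong; cong₂; subst)

private
  variable
    a b x y : Atom
    A L : List Atom

-- A bare pair of maps rather than Function.Bundles._⇔_, so that it coincides with the
-- shape of ≐ and of conditions (1) and (2).
infix  3 _⇔_
infixr 2 _⟨⇔⟩_

_⇔_ : Set → Set → Set
P ⇔ Q = (P → Q) × (Q → P)

⇔-sym : ∀ {P Q} → P ⇔ Q → Q ⇔ P
⇔-sym (f , g) = g , f

_⟨⇔⟩_ : ∀ {P Q R} → P ⇔ Q → Q ⇔ R → P ⇔ R
(f , g) ⟨⇔⟩ (h , k) = (λ p → h (f p)) , (λ r → g (k r))

≡⇒⇔ : ∀ {S : Set} (X : S → Set) {p q} → p ≡ q → X p ⇔ X q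
≡⇒⇔ X refl = (λ x → x) , (λ x → x)

-- Opaque: only the freshness of the chosen atom matters, and letting the type checker
-- unfold it inside the many freshness side conditions below is very costly.
opaque
  fresh : (L : List Atom) → ∃ λ c → c ∉ L
  fresh L = suc (max 0 L) , λ c∈L →
    <-irrefl refl (v<max⁺ 0 L (inj₂ (Any.map (λ { refl → n<1+n (max 0 L) }) c∈L)))

∉-∷⁺ : x ≢ y → x ∉ L → x ∉ y ∷ L
∉-∷⁺ x≢y x∉L (here x≡y)  = x≢y x≡y
∉-∷⁺ x≢y x∉L (there x∈L) = x∉L x∈L

∉-∷⁻ʰ : x ∉ y ∷ L → x ≢ y
∉-∷⁻ʰ x∉ x≡y = x∉ (here x≡y)

∉-∷⁻ᵗ : x ∉ y ∷ L → x ∉ L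
∉-∷⁻ᵗ x∉ x∈ = x∉ (there x∈)

∉-++⁺ : ∀ L {M} → x ∉ L → x ∉ M → x ∉ L ++ M
∉-++⁺ L x∉L x∉M x∈ with ∈-++⁻ L x∈
... | inj₁ x∈L = x∉L x∈L
... | inj₂ x∈M = x∉M x∈M

∉-++⁻ˡ : ∀ {M} → x ∉ L ++ M → x ∉ L
∉-++⁻ˡ x∉ x∈ = x∉ (∈-++⁺ˡ x∈)

∉-++⁻ʳ : ∀ L {M} → x ∉ L ++ M → x ∉ M
∉-++⁻ʳ L x∉ x∈ = x∉ (∈-++⁺ʳ L x∈)

≢-sym : a ≢ b → b ≢ a
≢-sym a≢b b≡a = a≢b (sym b≡a)

swapFun-left : ∀ a b → swapFun a b a ≡ b
swapFun-left a b with a ≟ a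
... | yes _   = refl
... | no a≢a = ⊥-elim (a≢a refl)

swapFun-right : ∀ a b → swapFun a b b ≡ a
swapFun-right a b with b ≟ a
... | yes b≡a = b≡a
... | no _ with b ≟ b
...   | yes _   = refl
...   | no b≢b = ⊥-elim (b≢b refl)

swapFun-other : x ≢ a → x ≢ b → swapFun a b x ≡ x
swapFun-other {x} {a} {b} x≢a x≢b with x ≟ a
... | yes x≡a = ⊥-elim (x≢a x≡a)
... | no _ with x ≟ b
...   | yes x≡b = ⊥-elim (x≢b x≡b)
...   | no _    = refl

swapFun-comm : ∀ a b x → swapFun a b x ≡ swapFun b a x
swapFun-comm a b x = by-cases (x ≟ a) (x ≟ b)
  where
  by-cases : Dec (x ≡ a) → Dec (x ≡ b) → swapFun a b x ≡ swapFun b a x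
  by-cases (yes refl) (yes refl) = refl
  by-cases (yes refl) (no _)     = trans (swapFun-left x b) (sym (swapFun-right b x))
  by-cases (no _)     (yes refl) = trans (swapFun-right a x) (sym (swapFun-left x a))
  by-cases (no x≢a)   (no x≢b)   = trans (swapFun-other x≢a x≢b) (sym (swapFun-other x≢b x≢a))

swapFun-fixes : a ∉ L → b ∉ L → ∀ x → x ∈ L → swapFun a b x ≡ x
swapFun-fixes a∉L b∉L x x∈L =
  swapFun-other (λ x≡a → a∉L (subst (_∈ _) x≡a x∈L)) (λ x≡b → b∉L (subst (_∈ _) x≡b x∈L))

to-injective : ∀ π {x y} → to π x ≡ to π y → x ≡ y
to-injective π {x} {y} eq =
  trans (sym (from-to π x)) (trans (cong (from π) eq) (from-to π y))

swapFun-conj : ∀ π a b x → to π (swapFun a b x) ≡ swapFun (to π a) (to π b) (to π x)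
swapFun-conj π a b x = by-cases (x ≟ a) (x ≟ b)
  where
  by-cases : Dec (x ≡ a) → Dec (x ≡ b) →
             to π (swapFun a b x) ≡ swapFun (to π a) (to π b) (to π x)
  by-cases (yes refl) _          =
    trans (cong (to π) (swapFun-left x b)) (sym (swapFun-left (to π x) (to π b)))
  by-cases (no _)     (yes refl) =
    trans (cong (to π) (swapFun-right a x)) (sym (swapFun-right (to π a) (to π x)))
  by-cases (no x≢a)   (no x≢b)   =
    trans (cong (to π) (swapFun-other x≢a x≢b))
          (sym (swapFun-other (λ eq → x≢a (to-injective π eq)) (λ eq → x≢b (to-injective π eq))))

infix 30 _⁻¹ₚ

_⁻¹ₚ : Perm → Perm
π ⁻¹ₚ = record
  { to = from π ; from = to π ; to-from = from-to π ; from-to = to-from π ; dom = dom π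
  ; fixes = λ a a∉ → trans (cong (from π) (sym (fixes π a a∉))) (from-to π a) }

∉-map⁺ : ∀ π → x ∉ L → to π x ∉ map (to π) L
∉-map⁺ {x} π x∉L πx∈ with ∈-map⁻ (to π) πx∈
... | y , y∈L , πx≡πy = x∉L (subst (_∈ _) (sym (to-injective π πx≡πy)) y∈L)

∉-map⁻ : ∀ π → a ∉ map (to π) L → from π a ∉ L
∉-map⁻ {a} π a∉ π⁻¹a∈L = a∉ (subst (_∈ _) (to-from π a) (∈-map⁺ (to π) π⁻¹a∈L))

∉-map-swap : x ∉ L → x ≢ a → x ≢ b → x ∉ map (swapFun a b) L
∉-map-swap {x} {L} {a} {b} x∉L x≢a x≢b =
  subst (_∉ map (swapFun a b) L) (swapFun-other x≢a x≢b) (∉-map⁺ (swap a b) x∉L)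

∉-map-swap-target : a ∉ L → b ∉ map (swapFun a b) L
∉-map-swap-target {a} {L} {b} a∉L =
  subst (_∉ map (swapFun a b) L) (swapFun-left a b) (∉-map⁺ (swap a b) a∉L)

module PermActionProperties {S : Set} {act : Perm → S → S}
                            (isPermAction : IsPermAction (≡.setoid S) act) where
  open IsPermAction isPermAction

  act-trivial : ∀ {π} → (∀ a → to π a ≡ a) → ∀ s → act π s ≡ s
  act-trivial {π} π≗id s = trans (act-ext {π} {idPerm} π≗id s) (act-id s)

  act²-ext : ∀ π₁ π₂ τ₁ τ₂ → (∀ a → to π₁ (to π₂ a) ≡ to τ₁ (to τ₂ a)) →
             ∀ s → act π₁ (act π₂ s) ≡ act τ₁ (act τ₂ s)
  act²-ext π₁ π₂ τ₁ τ₂ eq s =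
    trans (sym (act-∘ π₁ π₂ s)) (trans (act-ext {π₁ ∘ₚ π₂} {τ₁ ∘ₚ τ₂} eq s) (act-∘ τ₁ τ₂ s))

  act²-trivial : ∀ π τ → (∀ a → to π (to τ a) ≡ a) → ∀ s → act π (act τ s) ≡ s
  act²-trivial π τ eq s = trans (sym (act-∘ π τ s)) (act-trivial {π ∘ₚ τ} eq s)

  act-inverseˡ : ∀ π s → act (π ⁻¹ₚ) (act π s) ≡ s
  act-inverseˡ π = act²-trivial (π ⁻¹ₚ) π (from-to π)

  act-inverseʳ : ∀ π s → act π (act (π ⁻¹ₚ) s) ≡ s
  act-inverseʳ π = act²-trivial π (π ⁻¹ₚ) (to-from π)

  act-swap-swap : ∀ a b s → act (swap a b) (act (swap b a) s) ≡ s
  act-swap-swap a b = act²-trivial (swap a b) (swap b a)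
    (λ x → trans (cong (swapFun a b) (swapFun-comm b a x)) (to-from (swap a b) x))

  act-swap-cong : ∀ {a a′ b b′} → a ≡ a′ → b ≡ b′ → ∀ s → act (swap a b) s ≡ act (swap a′ b′) s
  act-swap-cong refl refl s = refl

  act-swap-conj : ∀ π a b s → act π (act (swap a b) s) ≡ act (swap (to π a) (to π b)) (act π s)
  act-swap-conj π a b = act²-ext π (swap a b) (swap (to π a) (to π b)) π (swapFun-conj π a b)

  supports-act : ∀ π {B s} → Supports (≡.setoid S) act B s →
                 Supports (≡.setoid S) act (map (to π) B) (act π s)
  supports-act π {B} {s} B-supp τ τ-fixes =
    trans (act²-ext τ π π σ (λ a → sym (to-from π _)) s) (cong (act π) (B-supp σ σ-fixes))
    where
    σ : Perm
    σ = π ⁻¹ₚ ∘ₚ (τ ∘ₚ π)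
    σ-fixes : ∀ b → b ∈ B → to σ b ≡ b
    σ-fixes b b∈B = trans (cong (from π) (τ-fixes (to π b) (∈-map⁺ (to π) b∈B))) (from-to π b)

  swap-fixes-supported : ∀ {B s} → Supports (≡.setoid S) act B s →
                         a ∉ B → b ∉ B → act (swap a b) s ≡ s
  swap-fixes-supported B-supp a∉B b∉B = B-supp (swap _ _) (swapFun-fixes a∉B b∉B)

module PowSigmaProperties (T : Termlike) (𝒫 : Amgis T) where
  open Termlike T
  open Amgis 𝒫
  open PowSigma T 𝒫
  open PermActionProperties permAction
  module ActU = PermActionProperties (IsNominal.isPermAction nominalU)
  open IsPermAction permAction using (act-ext; act-id; act-∘)

  private
    variable
      B : List Atom
      u : U
      X Y : Subset

  Fixes : Perm → List Atom → Set
  Fixes π A = ∀ a → a ∈ A → to π a ≡ a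

  Supportsˢ : List Atom → Subset → Set
  Supportsˢ A X = ∀ π → Fixes π A → (π ·ˢ X) ≐ X

  SupportsU : List Atom → U → Set
  SupportsU = Supports (≡.setoid U) actU

  supportU : ∀ u → ∃ λ B → SupportsU B u
  supportU = IsNominal.finSupp nominalU

  atm-supported : ∀ b → SupportsU (b ∷ []) (atm b)
  atm-supported b π π-fixes = trans (atm-equivariant π b) (cong atm (π-fixes b (here refl)))

  amg-cong : ∀ {p q u v a b} → p ≡ q → u ≡ v → a ≡ b → amg p u a ≡ amg q v b
  amg-cong refl refl refl = refl

  ≐-sym : X ≐ Y → Y ≐ X
  ≐-sym X≐Y p = ⇔-sym (X≐Y p)

  ≐-trans : ∀ {Z} → X ≐ Y → Y ≐ Z → X ≐ Z
  ≐-trans X≐Y Y≐Z p = X≐Y p ⟨⇔⟩ Y≐Z p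

  ∈-·ˢ : ∀ π X q → (π ·ˢ X) q ⇔ X (actP (π ⁻¹ₚ) q)
  ∈-·ˢ π X q = (λ { (p , p∈X , refl) → subst X (sym (act-inverseˡ π p)) p∈X })
             , (λ π⁻¹q∈X → actP (π ⁻¹ₚ) q , π⁻¹q∈X , act-inverseʳ π q)

  ∈-swap·ˢ : ∀ c a X q → (swap c a ·ˢ X) q ⇔ X (actP (swap c a) q)
  ∈-swap·ˢ c a X q = ∈-·ˢ (swap c a) X q ⟨⇔⟩ ≡⇒⇔ X (act-ext (λ _ → refl) q)

  ·ˢ-cong : ∀ π {X Y} → X ≐ Y → (π ·ˢ X) ≐ (π ·ˢ Y)
  ·ˢ-cong π X≐Y q = (λ { (p , p∈X , eq) → p , proj₁ (X≐Y p) p∈X , eq })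
                  , (λ { (p , p∈Y , eq) → p , proj₂ (X≐Y p) p∈Y , eq })

  ·ˢ-ext : ∀ {π τ} → (∀ a → to π a ≡ to τ a) → ∀ X → (π ·ˢ X) ≐ (τ ·ˢ X)
  ·ˢ-ext π≗τ X q = (λ { (p , p∈X , eq) → p , p∈X , trans (sym (act-ext π≗τ p)) eq })
                 , (λ { (p , p∈X , eq) → p , p∈X , trans (act-ext π≗τ p) eq })

  ·ˢ-identity : ∀ X → (idPerm ·ˢ X) ≐ X
  ·ˢ-identity X q = (λ { (p , p∈X , refl) → subst X (sym (act-id p)) p∈X })
                  , (λ q∈X → q , q∈X , act-id q)

  ·ˢ-∘ : ∀ π τ X → ((π ∘ₚ τ) ·ˢ X) ≐ (π ·ˢ (τ ·ˢ X))
  ·ˢ-∘ π τ X q =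
      (λ { (p , p∈X , refl) → actP τ p , (p , p∈X , refl) , sym (act-∘ π τ p) })
    , (λ { (_ , (p , p∈X , refl) , refl) → p , p∈X , act-∘ π τ p })

  ·ˢ²-ext : ∀ π₁ π₂ τ₁ τ₂ → (∀ a → to π₁ (to π₂ a) ≡ to τ₁ (to τ₂ a)) →
            ∀ X → (π₁ ·ˢ (π₂ ·ˢ X)) ≐ (τ₁ ·ˢ (τ₂ ·ˢ X))
  ·ˢ²-ext π₁ π₂ τ₁ τ₂ eq X =
    ≐-trans (≐-sym (·ˢ-∘ π₁ π₂ X)) (≐-trans (·ˢ-ext eq X) (·ˢ-∘ τ₁ τ₂ X))

  supported⇒invariant : Supportsˢ A X → ∀ π → Fixes π A → ∀ q → X q ⇔ X (actP π q)
  supported⇒invariant {X = X} A-supp π π-fixes q =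
      (λ q∈X → proj₁ (A-supp π π-fixes (actP π q)) (q , q∈X , refl))
    , (λ πq∈X → subst X (act-inverseˡ π q)
                  (proj₁ (∈-·ˢ π X (actP π q)) (proj₂ (A-supp π π-fixes (actP π q)) πq∈X)))

  supportsˢ-·ˢ : ∀ π → Supportsˢ A X → Supportsˢ (map (to π) A) (π ·ˢ X)
  supportsˢ-·ˢ {A} {X} π A-supp τ τ-fixes =
    ≐-trans (≐-sym (·ˢ-∘ τ π X))
      (≐-trans (·ˢ-ext (λ a → sym (to-from π _)) X)
        (≐-trans (·ˢ-∘ π σ X) (·ˢ-cong π (A-supp σ σ-fixes))))
    where
    σ : Perm
    σ = π ⁻¹ₚ ∘ₚ (τ ∘ₚ π)
    σ-fixes : Fixes σ A
    σ-fixes a a∈A = trans (cong (from π) (τ-fixes (to π a) (∈-map⁺ (to π) a∈A))) (from-to π a)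

  -- Conditions (1) and (2) of Pow_σ, required at every atom outside the support A
  -- instead of at cofinitely many atoms.
  record InPowAt (A : List Atom) (X : Subset) : Set where
    field
      supported : Supportsˢ A X
      amg-fresh : ∀ u a → a ∉ A → a #U u → ∀ p → X (amg p u a) ⇔ X p
      amg-atm   : ∀ d b → b ≢ d → b ∉ A → ∀ p → X (amg p (atm b) d) ⇔ X (actP (swap b d) p)
  open InPowAt

  inPow⇒inPowAt : InPow X → Supportsˢ A X → InPowAt A X
  inPow⇒inPowAt {X} {A} (_ , cond₁ , cond₂) A-supp = record
    { supported = A-supp ; amg-fresh = amg-fresh′ ; amg-atm = amg-atm′ }
    where
    amg-fresh′ : ∀ u a → a ∉ A → a #U u → ∀ p → X (amg p u a) ⇔ X p
    amg-fresh′ u a a∉A (B , B-supp , a∉B) p =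
      supported⇒invariant A-supp τ τ-fixes (amg p u a) ⟨⇔⟩ ≡⇒⇔ X τ-amg
      ⟨⇔⟩ proj₂ (cond₁ u) a′ a′∉E (actP τ p) ⟨⇔⟩ ⇔-sym (supported⇒invariant A-supp τ τ-fixes p)
      where
      E = proj₁ (cond₁ u)
      a′ = proj₁ (fresh (E ++ A ++ B))
      a′∉ = proj₂ (fresh (E ++ A ++ B))
      a′∉E = ∉-++⁻ˡ a′∉
      τ = swap a a′
      τ-fixes = swapFun-fixes a∉A (∉-++⁻ˡ (∉-++⁻ʳ E a′∉))
      τ-amg : actP τ (amg p u a) ≡ amg (actP τ p) u a′
      τ-amg = trans (amg-equivariant τ p u a)
        (amg-cong refl (B-supp τ (swapFun-fixes a∉B (∉-++⁻ʳ A (∉-++⁻ʳ E a′∉)))) (swapFun-left a a′))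
    amg-atm′ : ∀ d b → b ≢ d → b ∉ A → ∀ p → X (amg p (atm b) d) ⇔ X (actP (swap b d) p)
    amg-atm′ d b b≢d b∉A p =
      supported⇒invariant A-supp τ τ-fixes (amg p (atm b) d) ⟨⇔⟩ ≡⇒⇔ X τ-amg
      ⟨⇔⟩ proj₂ (cond₂ d) b′ b′∉E (actP τ p) ⟨⇔⟩ ≡⇒⇔ X τ-swap
      ⟨⇔⟩ ⇔-sym (supported⇒invariant A-supp τ τ-fixes (actP (swap b d) p))
      where
      E = proj₁ (cond₂ d)
      b′ = proj₁ (fresh (d ∷ E ++ A))
      b′∉ = proj₂ (fresh (d ∷ E ++ A))
      b′∉E = ∉-++⁻ˡ (∉-∷⁻ᵗ b′∉)
      τ = swap b b′
      τ-fixes = swapFun-fixes b∉A (∉-++⁻ʳ E (∉-∷⁻ᵗ b′∉))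
      τd≡d : swapFun b b′ d ≡ d
      τd≡d = swapFun-other (≢-sym b≢d) (≢-sym (∉-∷⁻ʰ b′∉))
      τ-amg : actP τ (amg p (atm b) d) ≡ amg (actP τ p) (atm b′) d
      τ-amg = trans (amg-equivariant τ p (atm b) d)
        (amg-cong refl (trans (atm-equivariant τ b) (cong atm (swapFun-left b b′))) τd≡d)
      τ-swap : actP (swap b′ d) (actP τ p) ≡ actP τ (actP (swap b d) p)
      τ-swap = sym (trans (act-swap-conj τ b d p) (act-swap-cong (swapFun-left b b′) τd≡d _))

  inPowAt⇒inPow : InPowAt A X → InPow X
  inPowAt⇒inPow {A} X∈ =
      (A , supported X∈)
    , (λ u → let (B , B-supp) = supportU u in
             A ++ B , λ a a∉ → amg-fresh X∈ u a (∉-++⁻ˡ a∉) (B , B-supp , ∉-++⁻ʳ A a∉))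
    , (λ d → d ∷ A , λ b b∉ → amg-atm X∈ d b (∉-∷⁻ʰ b∉) (∉-∷⁻ᵗ b∉))

  supportOf : InPow X → List Atom
  supportOf X∈ = proj₁ (proj₁ X∈)

  inPow⇒inPowAt-supportOf : (X∈ : InPow X) → InPowAt (supportOf X∈) X
  inPow⇒inPowAt-supportOf X∈ = inPow⇒inPowAt X∈ (proj₂ (proj₁ X∈))

  inPowAt-·ˢ : ∀ π → InPowAt A X → InPowAt (map (to π) A) (π ·ˢ X)
  inPowAt-·ˢ {A} {X} π X∈ = record
    { supported = supportsˢ-·ˢ π (supported X∈) ; amg-fresh = amg-fresh′ ; amg-atm = amg-atm′ }
    where
    π⁻¹ = π ⁻¹ₚ
    amg-fresh′ : ∀ u a → a ∉ map (to π) A → a #U u → ∀ p → (π ·ˢ X) (amg p u a) ⇔ (π ·ˢ X) p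
    amg-fresh′ u a a∉ (B , B-supp , a∉B) p =
      ∈-·ˢ π X (amg p u a) ⟨⇔⟩ ≡⇒⇔ X (amg-equivariant π⁻¹ p u a)
      ⟨⇔⟩ amg-fresh X∈ (actU π⁻¹ u) (from π a) (∉-map⁻ π a∉)
            (map (from π) B , ActU.supports-act π⁻¹ B-supp , ∉-map⁺ π⁻¹ a∉B) (actP π⁻¹ p)
      ⟨⇔⟩ ⇔-sym (∈-·ˢ π X p)
    amg-atm′ : ∀ d b → b ≢ d → b ∉ map (to π) A →
               ∀ p → (π ·ˢ X) (amg p (atm b) d) ⇔ (π ·ˢ X) (actP (swap b d) p)
    amg-atm′ d b b≢d b∉ p =
      ∈-·ˢ π X (amg p (atm b) d)
      ⟨⇔⟩ ≡⇒⇔ X (trans (amg-equivariant π⁻¹ p (atm b) d)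
                   (cong (λ z → amg (actP π⁻¹ p) z (from π d)) (atm-equivariant π⁻¹ b)))
      ⟨⇔⟩ amg-atm X∈ (from π d) (from π b) (λ eq → b≢d (to-injective π⁻¹ eq)) (∉-map⁻ π b∉) (actP π⁻¹ p)
      ⟨⇔⟩ ≡⇒⇔ X (sym (act-swap-conj π⁻¹ b d p))
      ⟨⇔⟩ ⇔-sym (∈-·ˢ π X (actP (swap b d) p))

  ·ˢ-sub : ∀ π X a u → (π ·ˢ (X [ a ≔ u ]ˢ)) ≐ ((π ·ˢ X) [ to π a ≔ actU π u ]ˢ)
  ·ˢ-sub π X a u q =
      (λ q∈ → let (L , L-cofinite) = proj₁ (∈-·ˢ π (X [ a ≔ u ]ˢ) q) q∈ in
        map (to π) L , λ c c∉ →
          subst (λ c′ → (swap c′ (to π a) ·ˢ (π ·ˢ X)) (amg q (actU π u) c′)) (to-from π c)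
            (proj₁ (at (from π c)) (L-cofinite (from π c) (∉-map⁻ π c∉))))
    , (λ { (L , L-cofinite) → proj₂ (∈-·ˢ π (X [ a ≔ u ]ˢ) q)
        (map (from π) L , λ c c∉ → proj₂ (at c) (L-cofinite (to π c) (∉-map⁻ π⁻¹ c∉))) })
    where
    π⁻¹ = π ⁻¹ₚ
    π⁻¹-amg : ∀ c → actP π⁻¹ (amg q (actU π u) (to π c)) ≡ amg (actP π⁻¹ q) u c
    π⁻¹-amg c = trans (amg-equivariant π⁻¹ q (actU π u) (to π c))
                      (amg-cong refl (ActU.act-inverseˡ π u) (from-to π c))
    conj : ∀ c s → actP π⁻¹ (actP (swap (to π c) (to π a)) s) ≡ actP (swap c a) (actP π⁻¹ s)
    conj c s = trans (act-swap-conj π⁻¹ (to π c) (to π a) s)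
                     (act-swap-cong (from-to π c) (from-to π a) _)
    at : ∀ c → (swap c a ·ˢ X) (amg (actP π⁻¹ q) u c)
             ⇔ (swap (to π c) (to π a) ·ˢ (π ·ˢ X)) (amg q (actU π u) (to π c))
    at c = ∈-swap·ˢ c a X _
      ⟨⇔⟩ ≡⇒⇔ X (sym (trans (conj c _) (cong (actP (swap c a)) (π⁻¹-amg c))))
      ⟨⇔⟩ ⇔-sym (∈-·ˢ π X _) ⟨⇔⟩ ⇔-sym (∈-swap·ˢ (to π c) (to π a) (π ·ˢ X) _)

  ·ˢ-sub′ : ∀ π X {a b u v} → to π a ≡ b → actU π u ≡ v →
            (π ·ˢ (X [ a ≔ u ]ˢ)) ≐ ((π ·ˢ X) [ b ≔ v ]ˢ)
  ·ˢ-sub′ π X refl refl = ·ˢ-sub π X _ _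

  sub-cong : ∀ {X Y} a u → X ≐ Y → (X [ a ≔ u ]ˢ) ≐ (Y [ a ≔ u ]ˢ)
  sub-cong a u X≐Y p =
      (λ { (L , h) → L , λ c c∉L → proj₁ (·ˢ-cong (swap c a) X≐Y (amg p u c)) (h c c∉L) })
    , (λ { (L , h) → L , λ c c∉L → proj₂ (·ˢ-cong (swap c a) X≐Y (amg p u c)) (h c c∉L) })

  subAt : Subset → Atom → U → Atom → Subset
  subAt X a u c p = (swap c a ·ˢ X) (amg p u c)

  -- Introduce c′ by (2), commute the two amgis steps by the amgis axiom, drop the one at
  -- c′ by (1), and undo p′ = (c c′)·p using that (c c′) fixes A and u.
  subAt-fresh-irrelevant :
    InPowAt A X → SupportsU B u → ∀ {c c′} → c ≢ c′ →
    c ≢ a → c ∉ A → c ∉ B → c′ ≢ a → c′ ∉ A → c′ ∉ B →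
    ∀ p → subAt X a u c p ⇔ subAt X a u c′ p
  subAt-fresh-irrelevant {A} {X} {B} {u} {a} X∈ B-supp {c} {c′} c≢c′ c≢a c∉A c∉B c′≢a c′∉A c′∉B p =
    ≡⇒⇔ X′ (sym c′c-amg) ⟨⇔⟩ ⇔-sym (amg-atm X′∈ c c′ (≢-sym c≢c′) c′∉ (amg p′ u c′))
    ⟨⇔⟩ ≡⇒⇔ X′ amgis
    ⟨⇔⟩ amg-fresh X′∈ u c′ c′∉ (B , B-supp , c′∉B) (amg p′ u c) ⟨⇔⟩ ∈-swap·ˢ c a X _
    ⟨⇔⟩ ≡⇒⇔ X swaps ⟨⇔⟩ ⇔-sym (supported⇒invariant (supported X∈) (swap c c′) cc′-fixes _)
    ⟨⇔⟩ ⇔-sym (∈-swap·ˢ c′ a X (amg p u c′))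
    where
    X′ = swap c a ·ˢ X
    X′∈ = inPowAt-·ˢ (swap c a) X∈
    c′∉ : c′ ∉ map (swapFun c a) A
    c′∉ = ∉-map-swap c′∉A (≢-sym c≢c′) c′≢a
    cc′-fixes = swapFun-fixes c∉A c′∉A
    p′ = actP (swap c c′) p
    c′c-amg : actP (swap c′ c) (amg p′ u c′) ≡ amg p u c
    c′c-amg = trans (amg-equivariant (swap c′ c) p′ u c′)
      (amg-cong (act-swap-swap c′ c p) (ActU.swap-fixes-supported B-supp c′∉B c∉B) (swapFun-left c′ c))
    amgis : amg (amg p′ u c′) (atm c′) c ≡ amg (amg p′ u c) u c′
    amgis = trans (amg-ax c c′ p′ (atm c′) u c≢c′ (B , B-supp , c∉B))
                  (cong (λ z → amg (amg p′ z c) u c′) (ax-var c′ u))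
    cc′-amg : actP (swap c c′) (amg p u c′) ≡ amg p′ u c
    cc′-amg = trans (amg-equivariant (swap c c′) p u c′)
      (amg-cong refl (ActU.swap-fixes-supported B-supp c∉B c′∉B) (swapFun-right c c′))
    swaps : actP (swap c a) (amg p′ u c) ≡ actP (swap c c′) (actP (swap c′ a) (amg p u c′))
    swaps = sym (begin
      actP (swap c c′) (actP (swap c′ a) (amg p u c′))
        ≡⟨ act-swap-conj (swap c c′) c′ a _ ⟩
      actP (swap (swapFun c c′ c′) (swapFun c c′ a)) (actP (swap c c′) (amg p u c′))
        ≡⟨ act-swap-cong (swapFun-right c c′) (swapFun-other (≢-sym c≢a) (≢-sym c′≢a)) _ ⟩
      actP (swap c a) (actP (swap c c′) (amg p u c′))
        ≡⟨ cong (actP (swap c a)) cc′-amg ⟩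
      actP (swap c a) (amg p′ u c) ∎)
      where open ≡.≡-Reasoning

  ∈-sub : ∀ {c} → InPowAt A X → SupportsU B u → c ≢ a → c ∉ A → c ∉ B →
          ∀ p → (X [ a ≔ u ]ˢ) p ⇔ subAt X a u c p
  ∈-sub {A = A} {X = X} {B = B} {u = u} {a = a} {c = c} X∈ B-supp c≢a c∉A c∉B p = at-c , from-c
    where
    at-c : (X [ a ≔ u ]ˢ) p → subAt X a u c p
    at-c (L , L-cofinite) =
      proj₁ (subAt-fresh-irrelevant X∈ B-supp (∉-∷⁻ʰ c₀∉) c₀≢a c₀∉A c₀∉B c≢a c∉A c∉B p)
            (L-cofinite c₀ (∉-++⁻ˡ c₀∉L++))
      where
      c₀ = proj₁ (fresh (c ∷ L ++ a ∷ A ++ B))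
      c₀∉ = proj₂ (fresh (c ∷ L ++ a ∷ A ++ B))
      c₀∉L++ = ∉-∷⁻ᵗ c₀∉
      c₀∉a∷ = ∉-++⁻ʳ L c₀∉L++
      c₀≢a = ∉-∷⁻ʰ c₀∉a∷
      c₀∉A = ∉-++⁻ˡ (∉-∷⁻ᵗ c₀∉a∷)
      c₀∉B = ∉-++⁻ʳ A (∉-∷⁻ᵗ c₀∉a∷)
    from-c : subAt X a u c p → (X [ a ≔ u ]ˢ) p
    from-c c∈ = c ∷ a ∷ A ++ B , λ c′ c′∉ →
      let c′∉A++B = ∉-∷⁻ᵗ (∉-∷⁻ᵗ c′∉) in
      proj₁ (subAt-fresh-irrelevant X∈ B-supp (≢-sym (∉-∷⁻ʰ c′∉)) c≢a c∉A c∉B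
               (∉-∷⁻ʰ (∉-∷⁻ᵗ c′∉)) (∉-++⁻ˡ c′∉A++B) (∉-++⁻ʳ A c′∉A++B) p) c∈

  swap-sub-atm : ∀ {d} → b ≢ d → SupportsU B u → b ∉ B → actU (swap b d) (subU u d (atm b)) ≡ u
  swap-sub-atm {b = b} {B = B} {u = u} {d = d} b≢d B-supp b∉B = begin
    actU (swap b d) (subU u d (atm b))
      ≡⟨ subU-equivariant (swap b d) u d (atm b) ⟩
    subU (actU (swap b d) u) (swapFun b d d) (actU (swap b d) (atm b))
      ≡⟨ cong₂ (subU (actU (swap b d) u)) (swapFun-right b d)
               (trans (atm-equivariant (swap b d) b) (cong atm (swapFun-left b d))) ⟩
    subU (actU (swap b d) u) b (atm d)
      ≡⟨ ax-alpha b d (actU (swap b d) u) (atm d) b≢d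
           (map (swapFun b d) B , ActU.supports-act (swap b d) B-supp , ∉-map-swap-target b∉B) ⟩
    subU (actU (swap d b) (actU (swap b d) u)) d (atm d)
      ≡⟨ ax-id d _ ⟩
    actU (swap d b) (actU (swap b d) u)
      ≡⟨ ActU.act-swap-swap d b u ⟩
    u ∎
    where open ≡.≡-Reasoning

  inPowAt-sub : InPowAt A X → SupportsU B u → InPowAt (a ∷ A ++ B) (X [ a ≔ u ]ˢ)
  inPowAt-sub {A = A} {X = X} {B = B} {u = u} {a = a} X∈ B-supp = record
    { supported = supported′ ; amg-fresh = amg-fresh′ ; amg-atm = amg-atm′ }
    where
    Z = X [ a ≔ u ]ˢ
    X′∈ : ∀ c → InPowAt (map (swapFun c a) A) (swap c a ·ˢ X)
    X′∈ c = inPowAt-·ˢ (swap c a) X∈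
    supported′ : Supportsˢ (a ∷ A ++ B) Z
    supported′ π π-fixes =
      ≐-trans (·ˢ-sub′ π X (π-fixes a (here refl)) (B-supp π (λ b b∈B → π-fixes b (there (∈-++⁺ʳ A b∈B)))))
              (sub-cong a u (supported X∈ π (λ b b∈A → π-fixes b (there (∈-++⁺ˡ b∈A)))))
    amg-fresh′ : ∀ v b → b ∉ a ∷ A ++ B → b #U v → ∀ p → Z (amg p v b) ⇔ Z p
    amg-fresh′ v b b∉ (Bv , Bv-supp , b∉Bv) p =
      ∈-sub X∈ B-supp c≢a c∉A c∉B (amg p v b) ⟨⇔⟩ ≡⇒⇔ (swap c a ·ˢ X) amgis
      ⟨⇔⟩ amg-fresh (X′∈ c) v b b∉A′ (Bv , Bv-supp , b∉Bv) (amg p u c)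
      ⟨⇔⟩ ⇔-sym (∈-sub X∈ B-supp c≢a c∉A c∉B p)
      where
      b∉A++B = ∉-∷⁻ᵗ b∉
      c = proj₁ (fresh (b ∷ a ∷ A ++ B ++ Bv))
      c∉ = proj₂ (fresh (b ∷ a ∷ A ++ B ++ Bv))
      c≢b = ∉-∷⁻ʰ c∉
      c≢a = ∉-∷⁻ʰ (∉-∷⁻ᵗ c∉)
      c∉A = ∉-++⁻ˡ (∉-∷⁻ᵗ (∉-∷⁻ᵗ c∉))
      c∉B++Bv = ∉-++⁻ʳ A (∉-∷⁻ᵗ (∉-∷⁻ᵗ c∉))
      c∉B = ∉-++⁻ˡ c∉B++Bv
      b∉A′ = ∉-map-swap (∉-++⁻ˡ b∉A++B) (≢-sym c≢b) (∉-∷⁻ʰ b∉)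
      amgis : amg (amg p v b) u c ≡ amg (amg p u c) v b
      amgis = trans (amg-ax c b p u v c≢b (Bv , Bv-supp , ∉-++⁻ʳ B c∉B++Bv))
        (cong (λ w → amg (amg p w c) v b) (ax-fresh b u v (B , B-supp , ∉-++⁻ʳ A b∉A++B)))
    amg-atm′ : ∀ d b → b ≢ d → b ∉ a ∷ A ++ B → ∀ p → Z (amg p (atm b) d) ⇔ Z (actP (swap b d) p)
    amg-atm′ d b b≢d b∉ p =
      ∈-sub X∈ B-supp c≢a c∉A c∉B (amg p (atm b) d) ⟨⇔⟩ ≡⇒⇔ (swap c a ·ˢ X) amgis
      ⟨⇔⟩ amg-atm (X′∈ c) d b b≢d b∉A′ (amg p w c) ⟨⇔⟩ ≡⇒⇔ (swap c a ·ˢ X) swap-amg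
      ⟨⇔⟩ ⇔-sym (∈-sub X∈ B-supp c≢a c∉A c∉B (actP (swap b d) p))
      where
      b∉A++B = ∉-∷⁻ᵗ b∉
      c = proj₁ (fresh (b ∷ d ∷ a ∷ A ++ B))
      c∉ = proj₂ (fresh (b ∷ d ∷ a ∷ A ++ B))
      c≢b = ∉-∷⁻ʰ c∉
      c≢d = ∉-∷⁻ʰ (∉-∷⁻ᵗ c∉)
      c≢a = ∉-∷⁻ʰ (∉-∷⁻ᵗ (∉-∷⁻ᵗ c∉))
      c∉A = ∉-++⁻ˡ (∉-∷⁻ᵗ (∉-∷⁻ᵗ (∉-∷⁻ᵗ c∉)))
      c∉B = ∉-++⁻ʳ A (∉-∷⁻ᵗ (∉-∷⁻ᵗ (∉-∷⁻ᵗ c∉)))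
      b∉A′ = ∉-map-swap (∉-++⁻ˡ b∉A++B) (≢-sym c≢b) (∉-∷⁻ʰ b∉)
      w = subU u d (atm b)
      amgis : amg (amg p (atm b) d) u c ≡ amg (amg p w c) (atm b) d
      amgis = amg-ax c d p u (atm b) c≢d (b ∷ [] , atm-supported b , ∉-∷⁺ c≢b (λ ()))
      swap-amg : actP (swap b d) (amg p w c) ≡ amg (actP (swap b d) p) u c
      swap-amg = trans (amg-equivariant (swap b d) p w c)
        (amg-cong refl (swap-sub-atm b≢d B-supp (∉-++⁻ʳ A b∉A++B)) (swapFun-other c≢b c≢d))

  ·ˢ-closed : ActClosed
  ·ˢ-closed π X X∈ = inPowAt⇒inPow (inPowAt-·ˢ π (inPow⇒inPowAt-supportOf X∈))

  sub-closed : SubClosed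
  sub-closed X a u X∈ =
    inPowAt⇒inPow (inPowAt-sub {a = a} (inPow⇒inPowAt-supportOf X∈) (proj₂ (supportU u)))

  sub-atm-id : InPowAt A X → (X [ a ≔ atm a ]ˢ) ≐ X
  sub-atm-id {A} {X} {a} X∈ p =
    ∈-sub X∈ (atm-supported a) c≢a c∉A (∉-∷⁺ c≢a (λ ())) p
    ⟨⇔⟩ amg-atm (inPowAt-·ˢ (swap c a) X∈) c a (≢-sym c≢a) (∉-map-swap-target c∉A) p
    ⟨⇔⟩ ∈-swap·ˢ c a X (actP (swap a c) p) ⟨⇔⟩ ≡⇒⇔ X (act-swap-swap c a p)
    where
    c = proj₁ (fresh (a ∷ A))
    c≢a = ∉-∷⁻ʰ (proj₂ (fresh (a ∷ A)))
    c∉A = ∉-∷⁻ᵗ (proj₂ (fresh (a ∷ A)))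

  sub-fresh : InPowAt A X → a ∉ A → (X [ a ≔ u ]ˢ) ≐ X
  sub-fresh {A} {X} {a} {u} X∈ a∉A p =
    ∈-sub X∈ Bu-supp c≢a c∉A c∉Bu p ⟨⇔⟩ ∈-swap·ˢ c a X (amg p u c)
    ⟨⇔⟩ ⇔-sym (supported⇒invariant (supported X∈) (swap c a) (swapFun-fixes c∉A a∉A) (amg p u c))
    ⟨⇔⟩ amg-fresh X∈ u c c∉A (Bu , Bu-supp , c∉Bu) p
    where
    Bu = proj₁ (supportU u)
    Bu-supp = proj₂ (supportU u)
    c = proj₁ (fresh (a ∷ A ++ Bu))
    c∉ = proj₂ (fresh (a ∷ A ++ Bu))
    c≢a = ∉-∷⁻ʰ c∉
    c∉A = ∉-++⁻ˡ (∉-∷⁻ᵗ c∉)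
    c∉Bu = ∉-++⁻ʳ A (∉-∷⁻ᵗ c∉)

  sub-alpha : InPowAt A X → a ≢ b → b ∉ A → (X [ a ≔ u ]ˢ) ≐ ((swap b a ·ˢ X) [ b ≔ u ]ˢ)
  sub-alpha {A} {X} {a} {b} {u} X∈ a≢b b∉A p =
    ∈-sub X∈ Bu-supp c≢a c∉A c∉Bu p ⟨⇔⟩ ∈-swap·ˢ c a X r
    ⟨⇔⟩ supported⇒invariant (supported X∈) (swap b c) (swapFun-fixes b∉A c∉A) _ ⟨⇔⟩ ≡⇒⇔ X swaps
    ⟨⇔⟩ ⇔-sym (∈-swap·ˢ b a X _) ⟨⇔⟩ ⇔-sym (∈-swap·ˢ c b (swap b a ·ˢ X) r)
    ⟨⇔⟩ ⇔-sym (∈-sub (inPowAt-·ˢ (swap b a) X∈) Bu-supp c≢b (∉-map-swap c∉A c≢b c≢a) c∉Bu p)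
    where
    Bu = proj₁ (supportU u)
    Bu-supp = proj₂ (supportU u)
    c = proj₁ (fresh (a ∷ b ∷ A ++ Bu))
    c∉ = proj₂ (fresh (a ∷ b ∷ A ++ Bu))
    c≢a = ∉-∷⁻ʰ c∉
    c≢b = ∉-∷⁻ʰ (∉-∷⁻ᵗ c∉)
    c∉A = ∉-++⁻ˡ (∉-∷⁻ᵗ (∉-∷⁻ᵗ c∉))
    c∉Bu = ∉-++⁻ʳ A (∉-∷⁻ᵗ (∉-∷⁻ᵗ c∉))
    r = amg p u c
    swaps : actP (swap b c) (actP (swap c a) r) ≡ actP (swap b a) (actP (swap c b) r)
    swaps = trans (act-swap-conj (swap b c) c a r)
      (trans (act-swap-cong (swapFun-right b c) (swapFun-other a≢b (≢-sym c≢a)) _)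
             (cong (actP (swap b a)) (act-ext (swapFun-comm b c) r)))

  -- Both sides are evaluated at the same fresh atoms, c for b and c′ for a; they meet at
  -- the amgis axiom combined with α-conversion of u[b:=v] in U.
  sub-subst : ∀ {v} → InPowAt A X → a ≢ b → a #U v →
              ((X [ a ≔ u ]ˢ) [ b ≔ v ]ˢ) ≐ ((X [ b ≔ v ]ˢ) [ a ≔ subU u b v ]ˢ)
  sub-subst {A} {X} {a} {b} {u} {v} X∈ a≢b (Bv , Bv-supp , a∉Bv) p =
    ∈-sub (inPowAt-sub X∈ Bu-supp) Bv-supp c≢b c∉Z₁ c∉Bv p
    ⟨⇔⟩ ·ˢ-sub′ (swap c b) X (swapFun-other (≢-sym c≢a) a≢b) refl (amg p v c)
    ⟨⇔⟩ ∈-sub (inPowAt-·ˢ (swap c b) X∈) (ActU.supports-act (swap c b) Bu-supp)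
              c′≢a (∉-map-swap c′∉A c′≢c c′≢b) (∉-map-swap c′∉Bu c′≢c c′≢b) (amg p v c)
    ⟨⇔⟩ ≡⇒⇔ (swap c′ a ·ˢ (swap c b ·ˢ X)) amgis
    ⟨⇔⟩ ·ˢ²-ext (swap c′ a) (swap c b) (swap c b) (swap c′ a) disjoint X _
    ⟨⇔⟩ ⇔-sym (∈-sub (inPowAt-·ˢ (swap c′ a) X∈) Bv-supp
                     c≢b (∉-map-swap c∉A (≢-sym c′≢c) c≢a) c∉Bv (amg p w c′))
    ⟨⇔⟩ ⇔-sym (·ˢ-sub′ (swap c′ a) X (swapFun-other (≢-sym c′≢b) (≢-sym a≢b))
                       (ActU.swap-fixes-supported Bv-supp c′∉Bv a∉Bv) (amg p w c′))
    ⟨⇔⟩ ⇔-sym (∈-sub (inPowAt-sub X∈ Bv-supp) Bw-supp c′≢a c′∉Z₂ c′∉Bw p)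
    where
    Bu = proj₁ (supportU u)
    Bu-supp = proj₂ (supportU u)
    w = subU u b v
    Bw = proj₁ (supportU w)
    Bw-supp = proj₂ (supportU w)
    M = A ++ Bu ++ Bv ++ Bw
    c = proj₁ (fresh (b ∷ a ∷ M))
    c∉ = proj₂ (fresh (b ∷ a ∷ M))
    c′ = proj₁ (fresh (c ∷ b ∷ a ∷ M))
    c′∉ = proj₂ (fresh (c ∷ b ∷ a ∷ M))
    c≢b = ∉-∷⁻ʰ c∉
    c≢a = ∉-∷⁻ʰ (∉-∷⁻ᵗ c∉)
    c∉A = ∉-++⁻ˡ (∉-∷⁻ᵗ (∉-∷⁻ᵗ c∉))
    c∉Bu = ∉-++⁻ˡ (∉-++⁻ʳ A (∉-∷⁻ᵗ (∉-∷⁻ᵗ c∉)))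
    c∉Bv = ∉-++⁻ˡ (∉-++⁻ʳ Bu (∉-++⁻ʳ A (∉-∷⁻ᵗ (∉-∷⁻ᵗ c∉))))
    c′≢c = ∉-∷⁻ʰ c′∉
    c′≢b = ∉-∷⁻ʰ (∉-∷⁻ᵗ c′∉)
    c′≢a = ∉-∷⁻ʰ (∉-∷⁻ᵗ (∉-∷⁻ᵗ c′∉))
    c′∉M = ∉-∷⁻ᵗ (∉-∷⁻ᵗ (∉-∷⁻ᵗ c′∉))
    c′∉A = ∉-++⁻ˡ c′∉M
    c′∉Bu = ∉-++⁻ˡ (∉-++⁻ʳ A c′∉M)
    c′∉Bv = ∉-++⁻ˡ (∉-++⁻ʳ Bu (∉-++⁻ʳ A c′∉M))
    c′∉Bw = ∉-++⁻ʳ Bv (∉-++⁻ʳ Bu (∉-++⁻ʳ A c′∉M))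
    c∉Z₁ : c ∉ a ∷ A ++ Bu
    c∉Z₁ = ∉-∷⁺ c≢a (∉-++⁺ A c∉A c∉Bu)
    c′∉Z₂ : c′ ∉ b ∷ A ++ Bv
    c′∉Z₂ = ∉-∷⁺ c′≢b (∉-++⁺ A c′∉A c′∉Bv)
    amgis : amg (amg p v c) (actU (swap c b) u) c′ ≡ amg (amg p w c′) v c
    amgis = trans (amg-ax c′ c p (actU (swap c b) u) v c′≢c (Bv , Bv-supp , c′∉Bv))
      (cong (λ z → amg (amg p z c′) v c) (sym (ax-alpha b c u v (≢-sym c≢b) (Bu , Bu-supp , c∉Bu))))
    disjoint : ∀ x → swapFun c′ a (swapFun c b x) ≡ swapFun c b (swapFun c′ a x)
    disjoint x = trans (swapFun-conj (swap c′ a) c b x)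
      (cong₂ (λ y z → swapFun y z (swapFun c′ a x))
             (swapFun-other (≢-sym c′≢c) c≢a) (swapFun-other (≢-sym c′≢b) (≢-sym a≢b)))

proposition3p33 : (T : Termlike) (𝒫 : Amgis T) →
    let open PowSigma T 𝒫 in
    Σ ActClosed λ clA → Σ SubClosed λ clS →
      IsSigmaAlgebra T PowSetoid (actPow clA) (subPow clS)
proposition3p33 T 𝒫 = ·ˢ-closed , sub-closed , record
  { nominal = record
      { isPermAction = record
          { act-cong = λ π → ·ˢ-cong π
          ; act-ext  = λ π≗τ X → ·ˢ-ext π≗τ (proj₁ X)
          ; act-id   = λ X → ·ˢ-identity (proj₁ X)
          ; act-∘    = λ π τ X → ·ˢ-∘ π τ (proj₁ X) }
      ; finSupp = λ X → proj₁ (proj₂ X) }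
  ; sub-cong        = λ a u → sub-cong a u
  ; sub-equivariant = λ π X → ·ˢ-sub π (proj₁ X)
  ; ax-id    = λ a X → sub-atm-id (inPow⇒inPowAt-supportOf (proj₂ X))
  ; ax-fresh = λ { a X u (A , A-supp , a∉A) →
                   sub-fresh (inPow⇒inPowAt (proj₂ X) A-supp) a∉A }
  ; ax-alpha = λ { a b X u a≢b (A , A-supp , b∉A) →
                   sub-alpha (inPow⇒inPowAt (proj₂ X) A-supp) a≢b b∉A }
  ; ax-subst = λ a b X u v a≢b a#v →
                 sub-subst (inPow⇒inPowAt-supportOf (proj₂ X)) a≢b a#v }
  where open PowSigmaProperties T 𝒫
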